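{- Let $n=4m>1$ and let $H$ be an $n\times n$ circulant Hadamard matrix with defining row $H_1=(h_1,\ldots,h_n)$. Then the total number of blocks of $H_1$ equals $2m$.
   Context: A Hadamard matrix is an $n\times n$ matrix with entries in $\{+1,-1\}$ whose rows are mutually orthogonal. It is circulant if, writing its first row (the defining row) as $H_1=(h_1,\ldots,h_n)$, its $i$-th row is $H_i=(h_{1-i+1},\ldots,h_{n-i+1})$ with subscripts taken modulo $n$. Regard $H_1$ as a circular (cyclic) sequence of $+1$'s and $-1$'s. A block is a maximal set of cyclically consecutive entries of $H_1$ that are all equal; it is positive or negative according to the sign of its entries, and its size $|B|$ is its number of entries. Thus $H_1$ decomposes cyclically into blocks of alternating sign. -}

module Defs where

open import Data.Nat using (ℕ; zero; suc; _+_; _∸_; NonZero)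
open import Data.Nat.DivMod using (_%_; m%n<n)
open import Data.Fin using (Fin; zero; suc; toℕ; fromℕ<)
open import Data.Integer using (ℤ; _*_; _≟_) renaming (_+_ to _+ℤ_; 0ℤ to 0z; 1ℤ to 1z; -1ℤ to -1z)
open import Data.Bool using (Bool; true; false; if_then_else_; not)
open import Data.Product using (_×_)
open import Data.Sum using (_⊎_)
open import Relation.Nullary using (¬_)
open import Relation.Nullary.Decidable using (⌊_⌋)
open import Relation.Binary.PropositionalEquality using (_≡_)

sumFin : ∀ {n} → (Fin n → ℤ) → ℤ
sumFin {zero}  f = 0z
sumFin {suc n} f = f zero +ℤ sumFin (λ k → f (suc k))

countFin : ∀ {n} → (Fin n → Bool) → ℕ
countFin {zero}  p = 0
countFin {suc n} p = (if p zero then 1 else 0) + countFin (λ k → p (suc k))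

idx : (n : ℕ) .{{_ : NonZero n}} → ℕ → Fin n
idx n a = fromℕ< (m%n<n a n)

PlusMinus : ℤ → Set
PlusMinus x = x ≡ 1z ⊎ x ≡ -1z

IsHadamard : (n : ℕ) → (Fin n → Fin n → ℤ) → Set
IsHadamard n M =
  (∀ i k → PlusMinus (M i k)) ×
  (∀ i j → ¬ (i ≡ j) → sumFin (λ k → M i k * M j k) ≡ 0z)

-- Circulant matrix with defining (first) row h (0-indexed):
-- row i, column k is h_{k - i mod n}, i.e. H_i = (h_{1-i+1},...,h_{n-i+1}).
circ : (n : ℕ) .{{_ : NonZero n}} → (Fin n → ℤ) → Fin n → Fin n → ℤ
circ n h i k = h (idx n (toℕ k + (n ∸ toℕ i)))

IsCirculantHadamard : (n : ℕ) .{{_ : NonZero n}} → (Fin n → ℤ) → Set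
IsCirculantHadamard n h = IsHadamard n (circ n h)

prev : (n : ℕ) .{{_ : NonZero n}} → Fin n → Fin n
prev n k = idx n (toℕ k + (n ∸ 1))

blockStart : (n : ℕ) .{{_ : NonZero n}} → (Fin n → ℤ) → Fin n → Bool
blockStart n h k = not ⌊ h k ≟ h (prev n k) ⌋

-- Number of blocks of the cyclic sequence h: the number of block starts,
-- except that a constant sequence forms a single block.
numBlocks : (n : ℕ) .{{_ : NonZero n}} → (Fin n → ℤ) → ℕ
numBlocks n h with countFin (blockStart n h)
... | zero  = 1
... | suc c = suc c

{-# OPTIONS --safe #-}
-- Row 1 of a circulant matrix is its defining row shifted by one place, so the
-- inner product of rows 0 and 1 is Σ h_k h_{k-1}: each of the c block starts
-- contributes -1 and each of the other n - c positions +1. Orthogonality gives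
-- n - 2c = 0, i.e. c = n/2 = 2m, and c > 0 means there are exactly c blocks.
module Submission where

open import Defs
open import Data.Nat using (ℕ; zero; suc; _+_; _*_; _<_; NonZero; s≤s; z≤n)
open import Data.Nat.Properties using (*-cancelˡ-≡; *-assoc; n≮0)
import Data.Nat.DivMod as DivMod
open import Data.Fin using (Fin; zero; suc; toℕ)
open import Data.Fin.Properties using (toℕ-injective; toℕ-fromℕ<; toℕ<n)
open import Data.Integer using (ℤ; +_; 1ℤ; -1ℤ; _≟_) renaming (_+_ to _+ℤ_; _*_ to _*ℤ_)
open import Data.Integer.Properties using (pos-+; pos-*; +-injective; +-identityˡ)
open import Data.Integer.Tactic.RingSolver using (solve-∀)
open import Data.Bool using (Bool; true; false; if_then_else_; not)
open import Data.Empty using (⊥-elim)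
open import Relation.Nullary.Decidable using (⌊_⌋)
open import Data.Sum using (inj₁; inj₂)
open import Data.Product using (_,_)
open import Relation.Binary.PropositionalEquality
  using (_≡_; _≢_; refl; sym; trans; cong; cong₂; subst; module ≡-Reasoning)

open ≡-Reasoning

sumFin-cong : ∀ {n} {f g : Fin n → ℤ} → (∀ k → f k ≡ g k) → sumFin f ≡ sumFin g
sumFin-cong {zero}  f≗g = refl
sumFin-cong {suc n} f≗g = cong₂ _+ℤ_ (f≗g zero) (sumFin-cong (λ k → f≗g (suc k)))

sign : Bool → ℤ
sign b = if b then -1ℤ else 1ℤ

sumFin-sign+2*countFin : ∀ {n} (b : Fin n → Bool) →
  sumFin (λ k → sign (b k)) +ℤ + 2 *ℤ + countFin b ≡ + n
sumFin-sign+2*countFin {zero}  b = refl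
sumFin-sign+2*countFin {suc n} b with b zero | sumFin-sign+2*countFin (λ k → b (suc k))
... | true | ih = begin
  (-1ℤ +ℤ s) +ℤ + 2 *ℤ + suc c     ≡⟨ cong (λ x → (-1ℤ +ℤ s) +ℤ + 2 *ℤ x) (pos-+ 1 c) ⟩
  (-1ℤ +ℤ s) +ℤ + 2 *ℤ (1ℤ +ℤ + c) ≡⟨ rearrange s (+ c) ⟩
  1ℤ +ℤ (s +ℤ + 2 *ℤ + c)         ≡⟨ cong (1ℤ +ℤ_) ih ⟩
  1ℤ +ℤ + n                        ≡⟨ sym (pos-+ 1 n) ⟩
  + suc n                          ∎
  where
  s : ℤ
  s = sumFin (λ k → sign (b (suc k)))
  c : ℕ
  c = countFin (λ k → b (suc k))
  rearrange : ∀ t x → (-1ℤ +ℤ t) +ℤ + 2 *ℤ (1ℤ +ℤ x) ≡ 1ℤ +ℤ (t +ℤ + 2 *ℤ x)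
  rearrange = solve-∀
... | false | ih = begin
  (1ℤ +ℤ s) +ℤ + 2 *ℤ + c  ≡⟨ rearrange s (+ c) ⟩
  1ℤ +ℤ (s +ℤ + 2 *ℤ + c)  ≡⟨ cong (1ℤ +ℤ_) ih ⟩
  1ℤ +ℤ + n                ≡⟨ sym (pos-+ 1 n) ⟩
  + suc n                  ∎
  where
  s : ℤ
  s = sumFin (λ k → sign (b (suc k)))
  c : ℕ
  c = countFin (λ k → b (suc k))
  rearrange : ∀ t x → (1ℤ +ℤ t) +ℤ + 2 *ℤ x ≡ 1ℤ +ℤ (t +ℤ + 2 *ℤ x)
  rearrange = solve-∀

PlusMinus⇒*≡sign : ∀ {a b} → PlusMinus a → PlusMinus b → a *ℤ b ≡ sign (not ⌊ a ≟ b ⌋)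
PlusMinus⇒*≡sign (inj₁ refl) (inj₁ refl) = refl
PlusMinus⇒*≡sign (inj₁ refl) (inj₂ refl) = refl
PlusMinus⇒*≡sign (inj₂ refl) (inj₁ refl) = refl
PlusMinus⇒*≡sign (inj₂ refl) (inj₂ refl) = refl

idx-toℕ+n : (n : ℕ) .{{_ : NonZero n}} (k : Fin n) → idx n (toℕ k + n) ≡ k
idx-toℕ+n n k = toℕ-injective (begin
  toℕ (idx n (toℕ k + n)) ≡⟨ toℕ-fromℕ< (DivMod.m%n<n (toℕ k + n) n) ⟩
  (toℕ k + n) DivMod.% n  ≡⟨ DivMod.[m+n]%n≡m%n (toℕ k) n ⟩
  toℕ k DivMod.% n        ≡⟨ DivMod.m<n⇒m%n≡m (toℕ<n k) ⟩
  toℕ k                   ∎)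

sumFin-sign-blockStart : (n : ℕ) .{{_ : NonZero n}} → 1 < n → (h : Fin n → ℤ) →
  IsCirculantHadamard n h → sumFin (λ k → sign (blockStart n h k)) ≡ + 0
sumFin-sign-blockStart (suc (suc n')) (s≤s (s≤s z≤n)) h (pm , orth) = begin
  sumFin (λ k → sign (blockStart n h k))                  ≡⟨ sumFin-cong adjacent-product ⟨
  sumFin (λ k → circ n h zero k *ℤ circ n h (suc zero) k) ≡⟨ orth zero (suc zero) (λ ()) ⟩
  + 0                                                     ∎
  where
  n : ℕ
  n = suc (suc n')
  row0 : ∀ k → circ n h zero k ≡ h k
  row0 k = cong h (idx-toℕ+n n k)
  h-PlusMinus : ∀ k → PlusMinus (h k)
  h-PlusMinus k = subst PlusMinus (row0 k) (pm zero k)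
  -- row 1 of circ n h is definitionally k ↦ h (prev n k)
  adjacent-product : ∀ k → circ n h zero k *ℤ circ n h (suc zero) k ≡ sign (blockStart n h k)
  adjacent-product k = trans (cong (_*ℤ h (prev n k)) (row0 k))
    (PlusMinus⇒*≡sign (h-PlusMinus k) (h-PlusMinus (prev n k)))

2*countFin-blockStart : (n : ℕ) .{{_ : NonZero n}} → 1 < n → (h : Fin n → ℤ) →
  IsCirculantHadamard n h → 2 * countFin (blockStart n h) ≡ n
2*countFin-blockStart n 1<n h had = +-injective (begin
  + (2 * c)                                            ≡⟨ pos-* 2 c ⟩
  + 2 *ℤ + c                                           ≡⟨ +-identityˡ (+ 2 *ℤ + c) ⟨
  + 0 +ℤ + 2 *ℤ + c                                    ≡⟨ cong (_+ℤ + 2 *ℤ + c) sum≡0 ⟨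
  sumFin (λ k → sign (blockStart n h k)) +ℤ + 2 *ℤ + c ≡⟨ sumFin-sign+2*countFin (blockStart n h) ⟩
  + n                                                  ∎)
  where
  c : ℕ
  c = countFin (blockStart n h)
  sum≡0 : sumFin (λ k → sign (blockStart n h k)) ≡ + 0
  sum≡0 = sumFin-sign-blockStart n 1<n h had

numBlocks≡countFin-blockStart : (n : ℕ) .{{_ : NonZero n}} (h : Fin n → ℤ) →
  countFin (blockStart n h) ≢ 0 → numBlocks n h ≡ countFin (blockStart n h)
numBlocks≡countFin-blockStart n h c≢0 with countFin (blockStart n h)
... | zero  = ⊥-elim (c≢0 refl)
... | suc c = refl

lemma1 : (n m : ℕ) .{{_ : NonZero n}} → n ≡ 4 * m → 1 < n →
         (h : Fin n → ℤ) → IsCirculantHadamard n h →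
         numBlocks n h ≡ 2 * m
lemma1 n m n≡4m 1<n h had =
  trans (numBlocks≡countFin-blockStart n h c≢0) c≡2m
  where
  c : ℕ
  c = countFin (blockStart n h)
  2c≡n : 2 * c ≡ n
  2c≡n = 2*countFin-blockStart n 1<n h had
  c≡2m : c ≡ 2 * m
  c≡2m = *-cancelˡ-≡ c (2 * m) 2 (trans 2c≡n (trans n≡4m (*-assoc 2 2 m)))
  c≢0 : c ≢ 0
  c≢0 c≡0 = n≮0 (subst (1 <_) (trans (sym 2c≡n) (cong (2 *_) c≡0)) 1<n)
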